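{- For all integers $1\leq r\leq n$, \[k(r,n)=\sum_{j=0}^{n-r}(n-r)_j\cdot|K_L(r,n-j)|.\]
   Context: Let $\mathfrak{S}_n$ be the group of permutations of $\{1,\dots,n\}$ in one-line notation. A permutation $w\in\mathfrak{S}_n$ contains the split pattern $3|12$ with respect to position $r$ if there are indices $i_1\leq r<i_2<i_3$ with $w(i_2)<w(i_3)<w(i_1)$; it contains $23|1$ with respect to position $r$ if there are indices $i_1<i_2\leq r<i_3$ with $w(i_3)<w(i_1)<w(i_2)$. $K(r,n)$ is the set of $w\in\mathfrak{S}_n$ avoiding both patterns with respect to position $r$, and $k(r,n)=|K(r,n)|$. $K_L(r,n)$ is the set of $w\in K(r,n)$ with $n\in\{w(k):k\leq r\}$. $(m)_j=m(m-1)\cdots(m-j+1)$ is the falling factorial, with $(m)_0=1$. -}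

module Defs where

open import Data.Nat using (ℕ; zero; suc; _+_; _*_; _∸_; _<_; _≤_)
open import Data.Nat.Properties using (_<?_; _≟_)
open import Data.Fin using (Fin; toℕ) renaming (_<_ to _<ᶠ_; _<?_ to _<ᶠ?_)
open import Data.Fin.Properties using (all?; any?) renaming (_≟_ to _≟ᶠ_)
open import Data.Vec using (Vec; []; _∷_; lookup)
open import Data.List using (List; []; _∷_; concatMap; map; filter; length)
open import Data.Product using (Σ; _×_; _,_; ∃)
open import Relation.Nullary using (Dec; ¬_)
open import Relation.Nullary.Decidable using (_×-dec_; _→-dec_; ¬?)
open import Relation.Binary.PropositionalEquality using (_≡_)
import Data.List as L

words : {A : Set} → (m : ℕ) → List A → List (Vec A m)
words zero    xs = [] ∷ []
words (suc m) xs = concatMap (λ x → map (x ∷_) (words m xs)) xs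

-- A permutation of {1,…,n} in one-line notation: a vector w of length n with
-- entries in Fin n (value v ∈ Fin n encodes v+1, position i encodes i+1)
-- which is injective.
IsPerm : {n : ℕ} → Vec (Fin n) n → Set
IsPerm {n} w = (i j : Fin n) → lookup w i ≡ lookup w j → i ≡ j

isPerm? : {n : ℕ} (w : Vec (Fin n) n) → Dec (IsPerm w)
isPerm? w = all? λ i → all? λ j → (lookup w i ≟ᶠ lookup w j) →-dec (i ≟ᶠ j)

perms : (n : ℕ) → List (Vec (Fin n) n)
perms n = filter isPerm? (words n (L.allFin n))

-- 1-indexed position p = toℕ i + 1, so "p ≤ r" is "toℕ i < r".
-- w contains 3|12 w.r.t. r: i1 ≤ r < i2 < i3, w(i2) < w(i3) < w(i1).
Contains312 : {n : ℕ} → ℕ → Vec (Fin n) n → Set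
Contains312 {n} r w = Σ (Fin n) λ i₁ → Σ (Fin n) λ i₂ → Σ (Fin n) λ i₃ →
  (toℕ i₁ < r) × (¬ (toℕ i₂ < r)) × (i₂ <ᶠ i₃) ×
  (lookup w i₂ <ᶠ lookup w i₃) × (lookup w i₃ <ᶠ lookup w i₁)

Contains231 : {n : ℕ} → ℕ → Vec (Fin n) n → Set
Contains231 {n} r w = Σ (Fin n) λ i₁ → Σ (Fin n) λ i₂ → Σ (Fin n) λ i₃ →
  (i₁ <ᶠ i₂) × (toℕ i₂ < r) × (¬ (toℕ i₃ < r)) ×
  (lookup w i₃ <ᶠ lookup w i₁) × (lookup w i₁ <ᶠ lookup w i₂)

contains312? : {n : ℕ} (r : ℕ) (w : Vec (Fin n) n) → Dec (Contains312 r w)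
contains312? r w = any? λ i₁ → any? λ i₂ → any? λ i₃ →
  (toℕ i₁ <? r) ×-dec ¬? (toℕ i₂ <? r) ×-dec (i₂ <ᶠ? i₃) ×-dec
  (lookup w i₂ <ᶠ? lookup w i₃) ×-dec (lookup w i₃ <ᶠ? lookup w i₁)

contains231? : {n : ℕ} (r : ℕ) (w : Vec (Fin n) n) → Dec (Contains231 r w)
contains231? r w = any? λ i₁ → any? λ i₂ → any? λ i₃ →
  (i₁ <ᶠ? i₂) ×-dec (toℕ i₂ <? r) ×-dec ¬? (toℕ i₃ <? r) ×-dec
  (lookup w i₃ <ᶠ? lookup w i₁) ×-dec (lookup w i₁ <ᶠ? lookup w i₂)

InK : {n : ℕ} → ℕ → Vec (Fin n) n → Set
InK r w = (¬ Contains312 r w) × (¬ Contains231 r w)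

inK? : {n : ℕ} (r : ℕ) (w : Vec (Fin n) n) → Dec (InK r w)
inK? r w = ¬? (contains312? r w) ×-dec ¬? (contains231? r w)

InKL : {n : ℕ} → ℕ → Vec (Fin n) n → Set
InKL {n} r w = InK r w × ∃ λ (k : Fin n) → (toℕ k < r) × (suc (toℕ (lookup w k)) ≡ n)

inKL? : {n : ℕ} (r : ℕ) (w : Vec (Fin n) n) → Dec (InKL r w)
inKL? {n} r w = inK? r w ×-dec any? λ k → (toℕ k <? r) ×-dec (suc (toℕ (lookup w k)) ≟ n)

k : ℕ → ℕ → ℕ
k r n = length (filter (inK? r) (perms n))

kL : ℕ → ℕ → ℕ
kL r n = length (filter (inKL? r) (perms n))

falling : ℕ → ℕ → ℕ
falling m zero    = 1
falling m (suc j) = (m ∸ j) * falling m j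

sumTo : ℕ → (ℕ → ℕ) → ℕ
sumTo zero    f = f 0
sumTo (suc N) f = sumTo N f + f (suc N)

-- In a permutation of K(r, n+1) the entry n+1 either occupies one of the first r positions,
-- which is K_L(r, n+1), or one of the n+1-r positions to the right of r. In the second case it
-- takes part in no occurrence of 3|12 or 23|1, since the largest entry of either pattern lies left
-- of the split; so deleting it is a bijection onto (positions right of r) × K(r, n). Hence
-- k(r, n+1) = |K_L(r, n+1)| + (n+1-r) k(r, n), and unrolling this recurrence down to
-- k(r, r) = |K_L(r, r)| gives the falling-factorial sum.

module Submission where

open import Defs
open import Algebra.Properties.CommutativeSemigroup as CSemigroup using ()
import Data.Fin as Fin
open import Data.Fin using (Fin; zero; suc; toℕ; fromℕ; inject₁; lower₁; punchIn; punchOut)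
open import Data.Fin.Properties
  using (any?; toℕ-injective; toℕ-fromℕ; toℕ-inject₁; toℕ<n; toℕ-lower₁;
         punchIn-injective; punchInᵢ≢i; punchIn-mono-≤; punchIn-cancel-≤; punchIn-punchOut;
         injective⇒existsPivot)
  renaming (_≟_ to _≟ᶠ_)
open import Data.List using (List; []; _∷_; _++_; length; map; filter; concatMap; cartesianProductWith; allFin)
open import Data.List.Membership.Propositional using (_∈_)
open import Data.List.Membership.Propositional.Properties
  using (∈-cartesianProductWith⁺; ∈-cartesianProductWith⁻; ∈-filter⁺; ∈-filter⁻; ∈-allFin)
open import Data.List.Membership.Propositional.Properties.WithK using (unique∧set⇒bag)
open import Data.List.Properties using (length-++; length-map; length-tabulate; map-tabulate; filter-all; filter-≐)
open import Data.List.Relation.Binary.BagAndSetEquality using (∼bag⇒↭)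
open import Data.List.Relation.Binary.Permutation.Propositional.Properties using (↭-length)
open import Data.List.Relation.Binary.Subset.Propositional using (_⊆_)
open import Data.List.Relation.Unary.All using ([]; universal)
open import Data.List.Relation.Unary.Any using (here)
open import Data.List.Relation.Unary.Unique.Propositional using (Unique; []; _∷_)
open import Data.List.Relation.Unary.Unique.Propositional.Properties using (cartesianProductWith⁺; filter⁺; allFin⁺)
open import Data.Nat using (ℕ; zero; suc; _+_; _*_; _∸_; _≤_; _<_; z≤n; s≤s; s≤s⁻¹)
open import Data.Nat.Properties
  using (_≟_; _≤?_; _<?_; *-commutativeSemigroup; ≤-antisym; <-irrefl; ≤⇒≯; <⇒≱; ≰⇒>; <-≤-trans; ≤-<-trans;
         n≤1+n; <⇒≢; suc-injective; n∸n≡0; m+n∸n≡m; m∸n+n≡m; *-assoc; *-identityˡ; *-distribˡ-+; +-assoc; +-suc)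
open import Data.Product using (_×_; _,_; proj₂; ∃)
open import Data.Sum using (_⊎_; inj₁; inj₂)
open import Data.Vec using (Vec; []; _∷_; lookup; insertAt; tabulate) renaming (map to mapᵥ)
open import Data.Vec.Properties using (∷-injective; insertAt-lookup; insertAt-punchIn; lookup-map; lookup∘tabulate)
open import Data.Vec.Relation.Binary.Pointwise.Extensional using (ext; Pointwise-≡⇒≡)
open import Data.Bool using (true; false)
open import Level using (0ℓ)
open import Function using (_∘_; id)
open import Function.Bundles using (mk⇔)
open import Relation.Nullary using (Dec; yes; no; ¬_; does; contradiction)
open import Relation.Nullary.Decidable using (_×-dec_)
open import Relation.Unary using (Pred; Decidable)
open import Relation.Unary.Properties using (_∩?_; ∁?)
open import Relation.Binary.PropositionalEquality using (_≡_; _≢_; refl; sym; trans; cong; cong₂; subst; subst₂; module ≡-Reasoning)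

open CSemigroup *-commutativeSemigroup using (x∙yz≈y∙xz)

unique∧⊆∧⊇⇒length≡ : {A : Set} {xs ys : List A} → Unique xs → Unique ys → xs ⊆ ys → ys ⊆ xs →
  length xs ≡ length ys
unique∧⊆∧⊇⇒length≡ xs! ys! xs⊆ys ys⊆xs = ↭-length (∼bag⇒↭ (unique∧set⇒bag xs! ys! (mk⇔ xs⊆ys ys⊆xs)))

length-cartesianProductWith : {A B C : Set} (f : A → B → C) (xs : List A) (ys : List B) →
  length (cartesianProductWith f xs ys) ≡ length xs * length ys
length-cartesianProductWith f []       ys = refl
length-cartesianProductWith f (x ∷ xs) ys = begin
  length (map (f x) ys ++ cartesianProductWith f xs ys)          ≡⟨ length-++ (map (f x) ys) ⟩
  length (map (f x) ys) + length (cartesianProductWith f xs ys)  ≡⟨ cong₂ _+_ (length-map (f x) ys) (length-cartesianProductWith f xs ys) ⟩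
  length ys + length xs * length ys                              ∎
  where open ≡-Reasoning

concatMap-map≡cartesianProductWith : {A B C : Set} (f : A → B → C) (xs : List A) (ys : List B) →
  concatMap (λ x → map (f x) ys) xs ≡ cartesianProductWith f xs ys
concatMap-map≡cartesianProductWith f []       ys = refl
concatMap-map≡cartesianProductWith f (x ∷ xs) ys = cong (map (f x) ys ++_) (concatMap-map≡cartesianProductWith f xs ys)

length-filter-split : {A : Set} {P Q : Pred A 0ℓ} (P? : Decidable P) (Q? : Decidable Q) (xs : List A) →
  length (filter P? xs) ≡ length (filter (P? ∩? Q?) xs) + length (filter (P? ∩? ∁? Q?) xs)
length-filter-split P? Q? [] = refl
length-filter-split P? Q? (x ∷ xs) with P? x | Q? x
... | yes _ | yes _ = cong suc (length-filter-split P? Q? xs)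
... | yes _ | no  _ = trans (cong suc (length-filter-split P? Q? xs)) (sym (+-suc _ _))
... | no  _ | _     = length-filter-split P? Q? xs

filter-map : {A B : Set} {P : Pred B 0ℓ} (P? : Decidable P) (f : A → B) (xs : List A) →
  filter P? (map f xs) ≡ map f (filter (P? ∘ f) xs)
filter-map P? f []       = refl
filter-map P? f (x ∷ xs) with does (P? (f x))
... | true  = cong (f x ∷_) (filter-map P? f xs)
... | false = filter-map P? f xs

length-filter-≤-toℕ : ∀ m r → length (filter (λ i → r ≤? toℕ i) (allFin m)) ≡ m ∸ r
length-filter-≤-toℕ zero    zero    = refl
length-filter-≤-toℕ zero    (suc r) = refl
length-filter-≤-toℕ (suc m) zero    =
  trans (cong length (filter-all (λ i → 0 ≤? toℕ i) {allFin (suc m)} (universal (λ _ → z≤n) _))) (length-tabulate id)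
length-filter-≤-toℕ (suc m) (suc r) = begin
  length (filter (λ i → suc r ≤? toℕ i) (allFin (suc m)))             ≡⟨ cong (length ∘ filter _) (map-tabulate id (Fin.suc {m})) ⟨
  length (filter (λ i → suc r ≤? toℕ i) (map Fin.suc (allFin m)))     ≡⟨ cong length (filter-map _ Fin.suc (allFin m)) ⟩
  length (map Fin.suc (filter (λ i → suc r ≤? suc (toℕ i)) (allFin m))) ≡⟨ length-map (Fin.suc {m}) (filter (λ i → suc r ≤? suc (toℕ i)) (allFin m)) ⟩
  length (filter (λ i → suc r ≤? suc (toℕ i)) (allFin m))             ≡⟨ cong length (filter-≐ _ _ (s≤s⁻¹ , s≤s) (allFin m)) ⟩
  length (filter (λ i → r ≤? toℕ i) (allFin m))                       ≡⟨ length-filter-≤-toℕ m r ⟩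
  m ∸ r                                                               ∎
  where open ≡-Reasoning

words-suc : {A : Set} (m : ℕ) (xs : List A) → words (suc m) xs ≡ cartesianProductWith _∷_ xs (words m xs)
words-suc m xs = concatMap-map≡cartesianProductWith _∷_ xs (words m xs)

words⁺ : {A : Set} (m : ℕ) {xs : List A} → Unique xs → Unique (words m xs)
words⁺ zero    xs! = [] ∷ []
words⁺ (suc m) {xs} xs! rewrite words-suc m xs =
  cartesianProductWith⁺ _∷_ ∷-injective xs! (words⁺ m xs!)

∈-words : {A : Set} (m : ℕ) {xs : List A} → (∀ a → a ∈ xs) → (v : Vec A m) → v ∈ words m xs
∈-words zero    xs-complete []      = here refl
∈-words (suc m) {xs} xs-complete (a ∷ v) rewrite words-suc m xs =
  ∈-cartesianProductWith⁺ _∷_ (xs-complete a) (∈-words m xs-complete v)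

perms⁺ : (n : ℕ) → Unique (perms n)
perms⁺ n = filter⁺ isPerm? (words⁺ n (allFin⁺ n))

∈-perms⁺ : {n : ℕ} {w : Vec (Fin n) n} → IsPerm w → w ∈ perms n
∈-perms⁺ {n} {w} w-perm = ∈-filter⁺ isPerm? (∈-words n ∈-allFin w) w-perm

∈-perms⁻ : {n : ℕ} {w : Vec (Fin n) n} → w ∈ perms n → IsPerm w
∈-perms⁻ {n} w∈ = proj₂ (∈-filter⁻ isPerm? {xs = words n (allFin n)} w∈)

toℕ-punchIn : ∀ {m} (q : Fin (suc m)) (j : Fin m) →
  toℕ (punchIn q j) ≡ toℕ j ⊎ (toℕ q ≤ toℕ j × toℕ (punchIn q j) ≡ suc (toℕ j))
toℕ-punchIn zero    j       = inj₂ (z≤n , refl)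
toℕ-punchIn (suc q) zero    = inj₁ refl
toℕ-punchIn (suc q) (suc j) with toℕ-punchIn q j
... | inj₁ eq         = inj₁ (cong suc eq)
... | inj₂ (q≤j , eq) = inj₂ (s≤s q≤j , cong suc eq)

punchIn-preserves-< : ∀ {m r} (q : Fin (suc m)) (j : Fin m) → r ≤ toℕ q → toℕ j < r → toℕ (punchIn q j) < r
punchIn-preserves-< q j r≤q j<r with toℕ-punchIn q j
... | inj₁ eq       = subst (_< _) (sym eq) j<r
... | inj₂ (q≤j , _) = contradiction (<-≤-trans j<r r≤q) (≤⇒≯ q≤j)

punchIn-reflects-< : ∀ {m r} (q : Fin (suc m)) (j : Fin m) → toℕ (punchIn q j) < r → toℕ j < r
punchIn-reflects-< q j ↑j<r with toℕ-punchIn q j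
... | inj₁ eq       = subst (_< _) eq ↑j<r
... | inj₂ (_ , eq) = ≤-<-trans (n≤1+n _) (subst (_< _) eq ↑j<r)

punchIn-mono-< : ∀ {m} (q : Fin (suc m)) (i j : Fin m) → toℕ i < toℕ j → toℕ (punchIn q i) < toℕ (punchIn q j)
punchIn-mono-< q i j i<j = ≰⇒> (<⇒≱ i<j ∘ punchIn-cancel-≤ q j i)

punchIn-cancel-< : ∀ {m} (q : Fin (suc m)) (i j : Fin m) → toℕ (punchIn q i) < toℕ (punchIn q j) → toℕ i < toℕ j
punchIn-cancel-< q i j ↑i<↑j = ≰⇒> (<⇒≱ ↑i<↑j ∘ punchIn-mono-≤ q j i)

punchIn-onto : ∀ {m} {q i : Fin (suc m)} → i ≢ q → ∃ λ j → punchIn q j ≡ i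
punchIn-onto i≢q = punchOut (i≢q ∘ sym) , punchIn-punchOut (i≢q ∘ sym)

module _ {n : ℕ} where

  record MaxInsertion (q : Fin (suc n)) (w : Vec (Fin n) n) (w′ : Vec (Fin (suc n)) (suc n)) : Set where
    field
      max-at         : toℕ (lookup w′ q) ≡ n
      lookup-punchIn : ∀ j → toℕ (lookup w′ (punchIn q j)) ≡ toℕ (lookup w j)

  open MaxInsertion

  insertMax : Fin (suc n) → Vec (Fin n) n → Vec (Fin (suc n)) (suc n)
  insertMax q w = insertAt (mapᵥ inject₁ w) q (fromℕ n)

  insertMax-maxInsertion : ∀ q w → MaxInsertion q w (insertMax q w)
  insertMax-maxInsertion q w = record
    { max-at         = trans (cong toℕ (insertAt-lookup (mapᵥ inject₁ w) q (fromℕ n))) (toℕ-fromℕ n)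
    ; lookup-punchIn = λ j → begin
        toℕ (lookup (insertMax q w) (punchIn q j)) ≡⟨ cong toℕ (insertAt-punchIn (mapᵥ inject₁ w) q (fromℕ n) j) ⟩
        toℕ (lookup (mapᵥ inject₁ w) j)            ≡⟨ cong toℕ (lookup-map j inject₁ w) ⟩
        toℕ (inject₁ (lookup w j))                 ≡⟨ toℕ-inject₁ (lookup w j) ⟩
        toℕ (lookup w j)                           ∎
    }
    where open ≡-Reasoning

  module _ {q : Fin (suc n)} {w : Vec (Fin n) n} {w′ : Vec (Fin (suc n)) (suc n)} (M : MaxInsertion q w w′) where

    lookup-punchIn<n : ∀ j → toℕ (lookup w′ (punchIn q j)) < n
    lookup-punchIn<n j = subst (_< n) (sym (lookup-punchIn M j)) (toℕ<n (lookup w j))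

    max-at-unique : ∀ i → toℕ (lookup w′ i) ≡ n → i ≡ q
    max-at-unique i w′i≡n with i ≟ᶠ q
    ... | yes i≡q = i≡q
    ... | no  i≢q with j , refl ← punchIn-onto i≢q = contradiction w′i≡n (<⇒≢ (lookup-punchIn<n j))

    below≢max-at : ∀ {i i′} → toℕ (lookup w′ i) < toℕ (lookup w′ i′) → i ≢ q
    below≢max-at {i′ = i′} w′i<w′i′ refl =
      <⇒≱ w′i<w′i′ (subst (toℕ (lookup w′ i′) ≤_) (sym (max-at M)) (s≤s⁻¹ (toℕ<n (lookup w′ i′))))

    isPerm-insert : IsPerm w → IsPerm w′
    isPerm-insert w-perm i j w′i≡w′j with i ≟ᶠ q
    ... | yes refl = sym (max-at-unique j (trans (cong toℕ (sym w′i≡w′j)) (max-at M)))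
    ... | no  i≢q with i′ , refl ← punchIn-onto i≢q with j ≟ᶠ q
    ...   | yes refl = max-at-unique (punchIn q i′) (trans (cong toℕ w′i≡w′j) (max-at M))
    ...   | no  j≢q with j′ , refl ← punchIn-onto j≢q =
      cong (punchIn q) (w-perm i′ j′ (toℕ-injective (begin
        toℕ (lookup w i′)               ≡⟨ lookup-punchIn M i′ ⟨
        toℕ (lookup w′ (punchIn q i′))  ≡⟨ cong toℕ w′i≡w′j ⟩
        toℕ (lookup w′ (punchIn q j′))  ≡⟨ lookup-punchIn M j′ ⟩
        toℕ (lookup w j′)               ∎)))
      where open ≡-Reasoning

    isPerm-remove : IsPerm w′ → IsPerm w
    isPerm-remove w′-perm i j wi≡wj = punchIn-injective q i j (w′-perm _ _ (toℕ-injective (begin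
      toℕ (lookup w′ (punchIn q i))  ≡⟨ lookup-punchIn M i ⟩
      toℕ (lookup w i)               ≡⟨ cong toℕ wi≡wj ⟩
      toℕ (lookup w j)               ≡⟨ lookup-punchIn M j ⟨
      toℕ (lookup w′ (punchIn q j))  ∎)))
      where open ≡-Reasoning

  maxInsertion-functional : ∀ {q w w′ w″} → MaxInsertion q w w′ → MaxInsertion q w w″ → w′ ≡ w″
  maxInsertion-functional {q} {w} {w′} {w″} M N = Pointwise-≡⇒≡ (ext same)
    where
    same : ∀ i → lookup w′ i ≡ lookup w″ i
    same i with i ≟ᶠ q
    ... | yes refl = toℕ-injective (trans (max-at M) (sym (max-at N)))
    ... | no  i≢q with j , refl ← punchIn-onto i≢q = toℕ-injective (trans (lookup-punchIn M j) (sym (lookup-punchIn N j)))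

  maxInsertion-injective : ∀ {q w v w′} → MaxInsertion q w w′ → MaxInsertion q v w′ → w ≡ v
  maxInsertion-injective M N = Pointwise-≡⇒≡ (ext λ j → toℕ-injective (trans (sym (lookup-punchIn M j)) (lookup-punchIn N j)))

  insertMax-injective : ∀ {q q′ w w′} → insertMax q w ≡ insertMax q′ w′ → q ≡ q′ × w ≡ w′
  insertMax-injective {q} {q′} {w} {w′} eq
    with refl ← max-at-unique (insertMax-maxInsertion q′ w′) q
                  (trans (cong (λ v → toℕ (lookup v q)) (sym eq)) (max-at (insertMax-maxInsertion q w)))
    = refl , maxInsertion-injective (insertMax-maxInsertion q w)
               (subst (MaxInsertion q w′) (sym eq) (insertMax-maxInsertion q w′))

  max-at-exists : ∀ (w′ : Vec (Fin (suc n)) (suc n)) → IsPerm w′ → ∃ λ q → toℕ (lookup w′ q) ≡ n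
  max-at-exists w′ w′-perm with q , _ , max≤w′q ← injective⇒existsPivot (λ {i} {j} → w′-perm i j) (fromℕ n) =
    q , ≤-antisym (s≤s⁻¹ (toℕ<n (lookup w′ q))) (subst (_≤ toℕ (lookup w′ q)) (toℕ-fromℕ n) max≤w′q)

  removeMax : ∀ {q} (w′ : Vec (Fin (suc n)) (suc n)) → IsPerm w′ → toℕ (lookup w′ q) ≡ n →
    ∃ λ w → MaxInsertion q w w′
  removeMax {q} w′ w′-perm w′q≡n = tabulate lowered , record
    { max-at         = w′q≡n
    ; lookup-punchIn = λ j → sym (trans (cong toℕ (lookup∘tabulate lowered j)) (toℕ-lower₁ _ (≢max j)))
    }
    where
    ≢max : ∀ j → n ≢ toℕ (lookup w′ (punchIn q j))
    ≢max j n≡ = punchInᵢ≢i q j (w′-perm _ _ (toℕ-injective (trans (sym n≡) (sym w′q≡n))))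
    lowered : Fin n → Fin n
    lowered j = lower₁ (lookup w′ (punchIn q j)) (≢max j)

MaxOnLeft : {m : ℕ} → ℕ → Vec (Fin m) m → Set
MaxOnLeft {m} r w = ∃ λ (k : Fin m) → (toℕ k < r) × (suc (toℕ (lookup w k)) ≡ m)

-- Spelled exactly as the second component of inKL?, so that inKL? r is definitionally
-- inK? r ∩? maxOnLeft? r.
maxOnLeft? : {m : ℕ} (r : ℕ) (w : Vec (Fin m) m) → Dec (MaxOnLeft r w)
maxOnLeft? {m} r w = any? λ k → (toℕ k <? r) ×-dec (suc (toℕ (lookup w k)) ≟ m)

module _ {n r : ℕ} {q : Fin (suc n)} {w : Vec (Fin n) n} {w′ : Vec (Fin (suc n)) (suc n)}
         (M : MaxInsertion q w w′) (r≤q : r ≤ toℕ q) where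

  open MaxInsertion M

  left≢max-at : ∀ {i} → toℕ i < r → i ≢ q
  left≢max-at i<r refl = <-irrefl refl (<-≤-trans i<r r≤q)

  ¬maxOnLeft : ¬ MaxOnLeft r w′
  ¬maxOnLeft (i , i<r , 1+w′i≡1+n) with j , refl ← punchIn-onto (left≢max-at i<r) =
    <⇒≢ (lookup-punchIn<n M j) (suc-injective 1+w′i≡1+n)

  lookup-punchIn-<⁺ : ∀ {i j} → toℕ (lookup w i) < toℕ (lookup w j) →
    toℕ (lookup w′ (punchIn q i)) < toℕ (lookup w′ (punchIn q j))
  lookup-punchIn-<⁺ {i} {j} = subst₂ _<_ (sym (lookup-punchIn i)) (sym (lookup-punchIn j))

  lookup-punchIn-<⁻ : ∀ {i j} → toℕ (lookup w′ (punchIn q i)) < toℕ (lookup w′ (punchIn q j)) →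
    toℕ (lookup w i) < toℕ (lookup w j)
  lookup-punchIn-<⁻ {i} {j} = subst₂ _<_ (lookup-punchIn i) (lookup-punchIn j)

  contains312⁺ : Contains312 r w → Contains312 r w′
  contains312⁺ (i₁ , i₂ , i₃ , i₁<r , i₂≮r , i₂<i₃ , v₂<v₃ , v₃<v₁) =
    punchIn q i₁ , punchIn q i₂ , punchIn q i₃ ,
    punchIn-preserves-< q i₁ r≤q i₁<r , i₂≮r ∘ punchIn-reflects-< q i₂ , punchIn-mono-< q i₂ i₃ i₂<i₃ ,
    lookup-punchIn-<⁺ v₂<v₃ , lookup-punchIn-<⁺ v₃<v₁

  contains231⁺ : Contains231 r w → Contains231 r w′
  contains231⁺ (i₁ , i₂ , i₃ , i₁<i₂ , i₂<r , i₃≮r , v₃<v₁ , v₁<v₂) =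
    punchIn q i₁ , punchIn q i₂ , punchIn q i₃ ,
    punchIn-mono-< q i₁ i₂ i₁<i₂ , punchIn-preserves-< q i₂ r≤q i₂<r , i₃≮r ∘ punchIn-reflects-< q i₃ ,
    lookup-punchIn-<⁺ v₃<v₁ , lookup-punchIn-<⁺ v₁<v₂

  contains312⁻ : Contains312 r w′ → Contains312 r w
  contains312⁻ (i₁ , i₂ , i₃ , i₁<r , i₂≮r , i₂<i₃ , v₂<v₃ , v₃<v₁)
    with j₁ , refl ← punchIn-onto (left≢max-at i₁<r)
       | j₂ , refl ← punchIn-onto (below≢max-at M v₂<v₃)
       | j₃ , refl ← punchIn-onto (below≢max-at M v₃<v₁) =
    j₁ , j₂ , j₃ ,
    punchIn-reflects-< q j₁ i₁<r , i₂≮r ∘ punchIn-preserves-< q j₂ r≤q , punchIn-cancel-< q j₂ j₃ i₂<i₃ ,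
    lookup-punchIn-<⁻ v₂<v₃ , lookup-punchIn-<⁻ v₃<v₁

  contains231⁻ : Contains231 r w′ → Contains231 r w
  contains231⁻ (i₁ , i₂ , i₃ , i₁<i₂ , i₂<r , i₃≮r , v₃<v₁ , v₁<v₂)
    with j₁ , refl ← punchIn-onto (below≢max-at M v₁<v₂)
       | j₂ , refl ← punchIn-onto (left≢max-at i₂<r)
       | j₃ , refl ← punchIn-onto (below≢max-at M v₃<v₁) =
    j₁ , j₂ , j₃ ,
    punchIn-cancel-< q j₁ j₂ i₁<i₂ , punchIn-reflects-< q j₂ i₂<r , i₃≮r ∘ punchIn-preserves-< q j₃ r≤q ,
    lookup-punchIn-<⁻ v₃<v₁ , lookup-punchIn-<⁻ v₁<v₂

  inK-insert : InK r w → InK r w′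
  inK-insert (avoids312 , avoids231) = avoids312 ∘ contains312⁻ , avoids231 ∘ contains231⁻

  inK-remove : InK r w′ → InK r w
  inK-remove (avoids312 , avoids231) = avoids312 ∘ contains312⁺ , avoids231 ∘ contains231⁺

module _ {n : ℕ} (r : ℕ) where

  -- Positions are 0-indexed: r ≤ toℕ q puts the inserted maximum to the right of the split.
  insertionPositions : List (Fin (suc n))
  insertionPositions = filter (λ q → r ≤? toℕ q) (allFin (suc n))

  insertions : List (Vec (Fin (suc n)) (suc n))
  insertions = cartesianProductWith insertMax insertionPositions (filter (inK? r) (perms n))

  kMaxOnRight : List (Vec (Fin (suc n)) (suc n))
  kMaxOnRight = filter (inK? r ∩? ∁? (maxOnLeft? r)) (perms (suc n))

  insertions⊆kMaxOnRight : insertions ⊆ kMaxOnRight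
  insertions⊆kMaxOnRight v∈
    with q , w , q∈ , w∈ , refl ← ∈-cartesianProductWith⁻ insertMax insertionPositions _ v∈
    with _ , r≤q ← ∈-filter⁻ (λ q → r ≤? toℕ q) {xs = allFin (suc n)} q∈
       | w∈perms , w∈K ← ∈-filter⁻ (inK? r) {xs = perms n} w∈ =
    ∈-filter⁺ (inK? r ∩? ∁? (maxOnLeft? r))
      (∈-perms⁺ (isPerm-insert M (∈-perms⁻ w∈perms)))
      (inK-insert M r≤q w∈K , ¬maxOnLeft M r≤q)
    where M = insertMax-maxInsertion q w

  kMaxOnRight⊆insertions : kMaxOnRight ⊆ insertions
  kMaxOnRight⊆insertions {v} v∈
    with v∈perms , v∈K , ¬left ← ∈-filter⁻ (inK? r ∩? ∁? (maxOnLeft? r)) {xs = perms (suc n)} v∈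
    with q , vq≡n ← max-at-exists v (∈-perms⁻ v∈perms)
    with r ≤? toℕ q
  ... | no  r≰q = contradiction (q , ≰⇒> r≰q , cong suc vq≡n) ¬left
  ... | yes r≤q with w , M ← removeMax v (∈-perms⁻ v∈perms) vq≡n =
    subst (_∈ insertions) (maxInsertion-functional (insertMax-maxInsertion q w) M)
      (∈-cartesianProductWith⁺ insertMax
        (∈-filter⁺ (λ q → r ≤? toℕ q) (∈-allFin q) r≤q)
        (∈-filter⁺ (inK? r) (∈-perms⁺ (isPerm-remove M (∈-perms⁻ v∈perms))) (inK-remove M r≤q v∈K)))

  length-kMaxOnRight : length kMaxOnRight ≡ (suc n ∸ r) * k r n
  length-kMaxOnRight = begin
    length kMaxOnRight                                                 ≡⟨ unique∧⊆∧⊇⇒length≡ kMaxOnRight! insertions! kMaxOnRight⊆insertions insertions⊆kMaxOnRight ⟩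
    length insertions                                                ≡⟨ length-cartesianProductWith insertMax insertionPositions _ ⟩
    length insertionPositions * k r n                                ≡⟨ cong (_* k r n) (length-filter-≤-toℕ (suc n) r) ⟩
    (suc n ∸ r) * k r n                                              ∎
    where
    open ≡-Reasoning
    kMaxOnRight! : Unique kMaxOnRight
    kMaxOnRight! = filter⁺ (inK? r ∩? ∁? (maxOnLeft? r)) (perms⁺ (suc n))
    insertions! : Unique insertions
    insertions! = cartesianProductWith⁺ insertMax insertMax-injective
      (filter⁺ (λ q → r ≤? toℕ q) (allFin⁺ (suc n))) (filter⁺ (inK? r) (perms⁺ n))

k-suc : ∀ r n → k r (suc n) ≡ kL r (suc n) + (suc n ∸ r) * k r n
k-suc r n = trans (length-filter-split (inK? r) (maxOnLeft? r) (perms (suc n))) (cong (kL r (suc n) +_) (length-kMaxOnRight r))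

sumTo-cong : ∀ d {f g : ℕ → ℕ} → (∀ j → f j ≡ g j) → sumTo d f ≡ sumTo d g
sumTo-cong zero    f≗g = f≗g 0
sumTo-cong (suc d) f≗g = cong₂ _+_ (sumTo-cong d f≗g) (f≗g (suc d))

sumTo-suc : ∀ d f → sumTo (suc d) f ≡ f 0 + sumTo d (f ∘ suc)
sumTo-suc zero    f = refl
sumTo-suc (suc d) f = trans (cong (_+ f (suc (suc d))) (sumTo-suc d f)) (+-assoc (f 0) _ _)

*-distribˡ-sumTo : ∀ c d f → c * sumTo d f ≡ sumTo d (λ j → c * f j)
*-distribˡ-sumTo c zero    f = refl
*-distribˡ-sumTo c (suc d) f = trans (*-distribˡ-+ c (sumTo d f) (f (suc d))) (cong (_+ c * f (suc d)) (*-distribˡ-sumTo c d f))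

falling-suc : ∀ d j → falling (suc d) (suc j) ≡ suc d * falling d j
falling-suc d zero    = refl
falling-suc d (suc j) = trans (cong ((d ∸ j) *_) (falling-suc d j)) (x∙yz≈y∙xz (d ∸ j) (suc d) (falling d j))

-- The step at m = r has coefficient (r+1) ∸ (r+1) = 0, so a (r+1) = b (r+1) starts the sum;
-- this base case is why the theorem needs 1 ≤ r.
unfold-recurrence : (a b : ℕ → ℕ) (r : ℕ) → (∀ m → a (suc m) ≡ b (suc m) + (suc m ∸ suc r) * a m) →
  ∀ d → a (d + suc r) ≡ sumTo d (λ j → falling d j * b (d + suc r ∸ j))
unfold-recurrence a b r step zero    = trans (step r) (cong (λ c → b (suc r) + c * a r) (n∸n≡0 r))
unfold-recurrence a b r step (suc d) = begin
  a (suc d + suc r)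
    ≡⟨ step (d + suc r) ⟩
  b (suc d + suc r) + (suc d + suc r ∸ suc r) * a (d + suc r)
    ≡⟨ cong₂ (λ c x → b (suc d + suc r) + c * x) (m+n∸n≡m (suc d) (suc r)) (unfold-recurrence a b r step d) ⟩
  b (suc d + suc r) + suc d * sumTo d (λ j → falling d j * b (d + suc r ∸ j))
    ≡⟨ cong (b (suc d + suc r) +_) (*-distribˡ-sumTo (suc d) d _) ⟩
  b (suc d + suc r) + sumTo d (λ j → suc d * (falling d j * b (d + suc r ∸ j)))
    ≡⟨ cong₂ _+_ (*-identityˡ _) (sumTo-cong d λ j →
          trans (cong (_* b (d + suc r ∸ j)) (falling-suc d j)) (*-assoc (suc d) (falling d j) (b (d + suc r ∸ j)))) ⟨
  1 * b (suc d + suc r) + sumTo d (λ j → falling (suc d) (suc j) * b (d + suc r ∸ j))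
    ≡⟨ sumTo-suc d (λ j → falling (suc d) j * b (suc d + suc r ∸ j)) ⟨
  sumTo (suc d) (λ j → falling (suc d) j * b (suc d + suc r ∸ j))
    ∎
  where open ≡-Reasoning

corollary2p2 : (r n : ℕ) → 1 ≤ r → r ≤ n →
    k r n ≡ sumTo (n ∸ r) (λ j → falling (n ∸ r) j * kL r (n ∸ j))
corollary2p2 (suc r) n (s≤s z≤n) r≤n =
  subst (λ m → k (suc r) m ≡ sumTo (n ∸ suc r) (λ j → falling (n ∸ suc r) j * kL (suc r) (m ∸ j)))
    (m∸n+n≡m r≤n)
    (unfold-recurrence (k (suc r)) (kL (suc r)) r (k-suc (suc r)) (n ∸ suc r))
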